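{- Let $G$ be a graph and let $v$ be a vertex of $G$ having two neighbors $u_1,u_2$ of degree 1. Then there is a minimum cPCP-set of $G$ containing neither $u_1$ nor $u_2$. Furthermore, if $v$ has degree at most 3, then there is a minimum cPCP-set of $G$ containing none of $v$, $u_1$, $u_2$.
   Context: All graphs are simple and undirected. A vertex set $S$ is a cPCP-set of $G$ if $G\setminus S$ has maximum degree at most 2; a minimum cPCP-set is one of minimum cardinality. -}

module Defs where

open import Data.Nat using (ℕ; _≤_)
open import Data.Bool using (Bool; true; false; _∧_; not)
open import Data.Fin using (Fin)
open import Data.Fin.Subset using (Subset; _∈_; _∉_; ∣_∣)
open import Data.Vec using (lookup)
open import Data.List using (List; filter; length; allFin)
open import Data.Product using (_×_; Σ-syntax)
open import Relation.Binary.PropositionalEquality using (_≡_)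
open import Relation.Nullary using (¬_)
open import Relation.Nullary.Decidable using (does)
open import Data.Bool using (T)
open import Data.Bool.Properties using (T?)

record Graph (n : ℕ) : Set where
  field
    adj   : Fin n → Fin n → Bool
    sym   : ∀ u v → adj u v ≡ adj v u
    irrefl : ∀ v → adj v v ≡ false
open Graph public

Adj : ∀ {n} → Graph n → Fin n → Fin n → Set
Adj G u v = adj G u v ≡ true

degree : ∀ {n} → Graph n → Fin n → ℕ
degree {n} G v = length (filter (λ w → T? (adj G v w)) (allFin n))

degreeOutside : ∀ {n} → Graph n → Subset n → Fin n → ℕ
degreeOutside {n} G S v =
  length (filter (λ w → T? (adj G v w ∧ not (lookup S w))) (allFin n))

IsCPCP : ∀ {n} → Graph n → Subset n → Set
IsCPCP G S = ∀ v → v ∉ S → degreeOutside G S v ≤ 2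

IsMinCPCP : ∀ {n} → Graph n → Subset n → Set
IsMinCPCP G S = IsCPCP G S × (∀ T → IsCPCP G T → ∣ S ∣ ≤ ∣ T ∣)

-- If a minimum cPCP-set S meets {u₁, u₂}, then (S ∖ {u₁, u₂}) ∪ {v} is no larger
-- and still a cPCP-set: the leaves have degree 1, and since they are adjacent
-- only to v, no other vertex acquires a new neighbour outside the set.
-- If moreover v ∈ S and deg v ≤ 3, then v has at most one neighbour w besides
-- u₁, u₂, and (S ∖ {v}) ∪ {w} works: outside it, v is adjacent only to the leaves.
module Submission where

open import Defs hiding (sym)
open import Data.Nat using (ℕ; zero; suc; _+_; _≤_; _<_; z≤n; s≤s; s≤s⁻¹)
open import Data.Nat.Properties
  using ( ≤-refl; ≤-trans; ≤-reflexive; _≤?_; _<?_; ≮⇒≥; +-comm; +-suc; +-monoʳ-≤; n≤1+n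
        ; module ≤-Reasoning )
open import Data.Bool using (Bool; true; false; _∧_; not; T?)
open import Data.Bool.Properties using (∧-zeroʳ; ∧-identityʳ)
open import Data.Fin using (Fin; zero; suc)
open import Data.Fin.Properties using (all?; _≟_)
open import Data.Fin.Subset
  using (Subset; _∈_; _∉_; ∣_∣; ⊤; ⁅_⁆; _∪_; _∩_; _─_; _-_; inside; outside; Nonempty)
open import Data.Fin.Subset.Properties
  using ( _∈?_; anySubset?; nonempty?; ∈⊤; x∈⁅x⁆; x∈⁅y⁆⇒x≡y; ∣⁅x⁆∣≡1; p⊆q⇒∣p∣≤∣q∣
        ; x∈p∪q⁺; x∈p∪q⁻; x∈p∩q⁺; x∈p∧x∉q⇒x∈p─q; x∈p∧x≢y⇒x∈p-y; p─q⊆p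
        ; p─q─r≡p─q∪r; p∩q≢∅⇒∣p─q∣<∣p∣; x∈p⇒∣p-x∣<∣p∣ )
open import Data.Vec using ([]; _∷_; lookup; tabulate; here; there)
open import Data.Vec.Properties using (lookup∘tabulate; []=⇒lookup; lookup⇒[]=)
open import Data.List using (filter; length)
import Data.List as List
open import Data.Product using (_×_; Σ-syntax; _,_; proj₁)
open import Data.Sum using (inj₁; inj₂)
open import Function using (_∘_; id)
open import Relation.Binary.PropositionalEquality
  using (_≡_; _≢_; refl; sym; trans; subst; cong; cong₂)
open import Relation.Nullary using (¬_; yes; no; contradiction; ¬?; _→-dec_; _×-dec_)
open import Relation.Unary using (Pred; Decidable)
open import Relation.Nullary.Decidable using (decidable-stable)

private
  variable
    n : ℕ
    x y : Fin n
    p q S : Subset n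

x∈p─q⇒x∉q : ∀ (p q : Subset n) → x ∈ p ─ q → x ∉ q
x∈p─q⇒x∉q (_ ∷ p) (outside ∷ q) here        ()
x∈p─q⇒x∉q (_ ∷ p) (_       ∷ q) (there x∈) (there x∈q) = x∈p─q⇒x∉q p q x∈ x∈q

∣p∪q∣≤∣p∣+∣q∣ : ∀ (p q : Subset n) → ∣ p ∪ q ∣ ≤ ∣ p ∣ + ∣ q ∣
∣p∪q∣≤∣p∣+∣q∣ []            []            = z≤n
∣p∪q∣≤∣p∣+∣q∣ (outside ∷ p) (outside ∷ q) = ∣p∪q∣≤∣p∣+∣q∣ p q
∣p∪q∣≤∣p∣+∣q∣ (outside ∷ p) (inside  ∷ q) =
  ≤-trans (s≤s (∣p∪q∣≤∣p∣+∣q∣ p q)) (≤-reflexive (sym (+-suc ∣ p ∣ ∣ q ∣)))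
∣p∪q∣≤∣p∣+∣q∣ (inside  ∷ p) (outside ∷ q) = s≤s (∣p∪q∣≤∣p∣+∣q∣ p q)
∣p∪q∣≤∣p∣+∣q∣ (inside  ∷ p) (inside  ∷ q) =
  s≤s (≤-trans (∣p∪q∣≤∣p∣+∣q∣ p q) (+-monoʳ-≤ ∣ p ∣ (n≤1+n ∣ q ∣)))

x∈p∧y∈p∧x≢y⇒2+∣p-x-y∣≤∣p∣ : x ∈ p → y ∈ p → x ≢ y → 2 + ∣ p - x - y ∣ ≤ ∣ p ∣
x∈p∧y∈p∧x≢y⇒2+∣p-x-y∣≤∣p∣ x∈p y∈p x≢y =
  ≤-trans (s≤s (x∈p⇒∣p-x∣<∣p∣ (x∈p∧x≢y⇒x∈p-y y∈p (x≢y ∘ sym)))) (x∈p⇒∣p-x∣<∣p∣ x∈p)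

x∈p∧y∈p∧∣p∣≤1⇒x≡y : x ∈ p → y ∈ p → ∣ p ∣ ≤ 1 → x ≡ y
x∈p∧y∈p∧∣p∣≤1⇒x≡y {x = x} {y = y} x∈p y∈p ∣p∣≤1 with x ≟ y
... | yes x≡y = x≡y
... | no  x≢y =
  contradiction (≤-trans (x∈p∧y∈p∧x≢y⇒2+∣p-x-y∣≤∣p∣ x∈p y∈p x≢y) ∣p∣≤1) λ { (s≤s ()) }

∣p∣<∣r∣∧∣q∣≤1⇒∣p∪q∣≤∣r∣ : ∀ (p q r : Subset n) →
                          ∣ p ∣ < ∣ r ∣ → ∣ q ∣ ≤ 1 → ∣ p ∪ q ∣ ≤ ∣ r ∣
∣p∣<∣r∣∧∣q∣≤1⇒∣p∪q∣≤∣r∣ p q r ∣p∣<∣r∣ ∣q∣≤1 = begin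
  ∣ p ∪ q ∣      ≤⟨ ∣p∪q∣≤∣p∣+∣q∣ p q ⟩
  ∣ p ∣ + ∣ q ∣  ≤⟨ +-monoʳ-≤ ∣ p ∣ ∣q∣≤1 ⟩
  ∣ p ∣ + 1      ≡⟨ +-comm ∣ p ∣ 1 ⟩
  suc ∣ p ∣      ≤⟨ ∣p∣<∣r∣ ⟩
  ∣ r ∣          ∎
  where open ≤-Reasoning

module _ {ℓ} {P : Pred (Subset n) ℓ} (P? : Decidable P) where

  IsSmallest : Subset n → Set ℓ
  IsSmallest M = P M × (∀ S → P S → ∣ M ∣ ≤ ∣ S ∣)

  smallest : ∀ S → P S → Σ[ M ∈ Subset n ] IsSmallest M
  smallest S PS = search ∣ S ∣ S PS ≤-refl
    where
    search : ∀ k S → P S → ∣ S ∣ ≤ k → Σ[ M ∈ Subset n ] IsSmallest M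
    search zero    S PS ∣S∣≤0 = S , PS , λ _ _ → ≤-trans ∣S∣≤0 z≤n
    search (suc k) S PS ∣S∣≤k+1 with anySubset? (λ T → P? T ×-dec ∣ T ∣ <? ∣ S ∣)
    ... | yes (T , PT , ∣T∣<∣S∣) = search k T PT (s≤s⁻¹ (≤-trans ∣T∣<∣S∣ ∣S∣≤k+1))
    ... | no  ∄smaller = S , PS , λ T PT → ≮⇒≥ (λ ∣T∣<∣S∣ → ∄smaller (T , PT , ∣T∣<∣S∣))

length-filter-tabulate : ∀ {m} (f : Fin m → Bool) (g : Fin n → Fin m) →
  length (filter (T? ∘ f) (List.tabulate g)) ≡ ∣ tabulate (f ∘ g) ∣
length-filter-tabulate {n = zero}  f g = refl
length-filter-tabulate {n = suc n} f g with f (g zero)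
... | true  = cong suc (length-filter-tabulate f (g ∘ suc))
... | false = length-filter-tabulate f (g ∘ suc)

tabulate-∧-not : ∀ (f : Fin n → Bool) (q : Subset n) →
  tabulate (λ i → f i ∧ not (lookup q i)) ≡ tabulate f ─ q
tabulate-∧-not f []            = refl
tabulate-∧-not f (inside  ∷ q) = cong₂ _∷_ (∧-zeroʳ (f zero)) (tabulate-∧-not (f ∘ suc) q)
tabulate-∧-not f (outside ∷ q) = cong₂ _∷_ (∧-identityʳ (f zero)) (tabulate-∧-not (f ∘ suc) q)

neighbours : Graph n → Fin n → Subset n
neighbours G x = tabulate (adj G x)

module _ (G : Graph n) where

  ∈-neighbours⁺ : Adj G x y → y ∈ neighbours G x
  ∈-neighbours⁺ {x = x} {y = y} x~y =
    lookup⇒[]= y (neighbours G x) (trans (lookup∘tabulate (adj G x) y) x~y)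

  ∈-neighbours⁻ : y ∈ neighbours G x → Adj G x y
  ∈-neighbours⁻ {y = y} {x = x} y∈N =
    trans (sym (lookup∘tabulate (adj G x) y)) ([]=⇒lookup y∈N)

  neighbours-sym : y ∈ neighbours G x → x ∈ neighbours G y
  neighbours-sym {y = y} {x = x} y∈N =
    ∈-neighbours⁺ (trans (Graph.sym G y x) (∈-neighbours⁻ y∈N))

  x∉neighbours-x : x ∉ neighbours G x
  x∉neighbours-x {x = x} x∈N with trans (sym (∈-neighbours⁻ x∈N)) (irrefl G x)
  ... | ()

  degree≡∣neighbours∣ : ∀ x → degree G x ≡ ∣ neighbours G x ∣
  degree≡∣neighbours∣ x = length-filter-tabulate (adj G x) id

  degreeOutside≡∣neighbours─S∣ : ∀ S x → degreeOutside G S x ≡ ∣ neighbours G x ─ S ∣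
  degreeOutside≡∣neighbours─S∣ S x =
    trans (length-filter-tabulate (λ w → adj G x w ∧ not (lookup S w)) id)
          (cong ∣_∣ (tabulate-∧-not (adj G x) S))

  degreeOutside≤∣q∣ : (∀ {w} → w ∈ neighbours G x → w ∉ S → w ∈ q) →
                      degreeOutside G S x ≤ ∣ q ∣
  degreeOutside≤∣q∣ {x = x} {S = S} {q = q} N∖S⊆q =
    subst (_≤ ∣ q ∣) (sym (degreeOutside≡∣neighbours─S∣ S x))
      (p⊆q⇒∣p∣≤∣q∣ λ w∈N∖S →
        N∖S⊆q (p─q⊆p (neighbours G x) S w∈N∖S) (x∈p─q⇒x∉q (neighbours G x) S w∈N∖S))

  degreeOutside-mono : ∀ {T} → (∀ {w} → w ∈ neighbours G x → w ∉ T → w ∉ S) →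
                       degreeOutside G T x ≤ degreeOutside G S x
  degreeOutside-mono {x = x} {S = S} N∖T⊆∁S =
    subst (_ ≤_) (sym (degreeOutside≡∣neighbours─S∣ S x))
      (degreeOutside≤∣q∣ λ w∈N w∉T → x∈p∧x∉q⇒x∈p─q w∈N (N∖T⊆∁S w∈N w∉T))

  ⊤-isCPCP : IsCPCP G ⊤
  ⊤-isCPCP x x∉⊤ = contradiction ∈⊤ x∉⊤

  isCPCP? : Decidable (IsCPCP G)
  isCPCP? S = all? λ x → ¬? (x ∈? S) →-dec (degreeOutside G S x ≤? 2)

  minCPCP-exists : Σ[ S ∈ Subset n ] IsMinCPCP G S
  minCPCP-exists = smallest isCPCP? ⊤ ⊤-isCPCP

  isMinCPCP-≤ : ∀ {T} → IsMinCPCP G S → IsCPCP G T → ∣ T ∣ ≤ ∣ S ∣ → IsMinCPCP G T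
  isMinCPCP-≤ (_ , S-min) T-cPCP ∣T∣≤∣S∣ =
    T-cPCP , λ U U-cPCP → ≤-trans ∣T∣≤∣S∣ (S-min U U-cPCP)

module TwoLeaves {n} (G : Graph n) {v u₁ u₂ : Fin n} (u₁≢u₂ : u₁ ≢ u₂)
  (v~u₁ : Adj G v u₁) (v~u₂ : Adj G v u₂)
  (deg-u₁ : degree G u₁ ≡ 1) (deg-u₂ : degree G u₂ ≡ 1) where

  leaves : Subset n
  leaves = ⁅ u₁ ⁆ ∪ ⁅ u₂ ⁆

  u₁∈leaves : u₁ ∈ leaves
  u₁∈leaves = x∈p∪q⁺ (inj₁ (x∈⁅x⁆ u₁))

  u₂∈leaves : u₂ ∈ leaves
  u₂∈leaves = x∈p∪q⁺ (inj₂ (x∈⁅x⁆ u₂))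

  ∈leaves-elim : ∀ {ℓ} (P : Fin n → Set ℓ) → P u₁ → P u₂ → x ∈ leaves → P x
  ∈leaves-elim P Pu₁ Pu₂ x∈L with x∈p∪q⁻ ⁅ u₁ ⁆ ⁅ u₂ ⁆ x∈L
  ... | inj₁ x∈⁅u₁⁆ = subst P (sym (x∈⁅y⁆⇒x≡y u₁ x∈⁅u₁⁆)) Pu₁
  ... | inj₂ x∈⁅u₂⁆ = subst P (sym (x∈⁅y⁆⇒x≡y u₂ x∈⁅u₂⁆)) Pu₂

  ∣leaves∣≤2 : ∣ leaves ∣ ≤ 2
  ∣leaves∣≤2 = subst (∣ leaves ∣ ≤_) (cong₂ _+_ (∣⁅x⁆∣≡1 u₁) (∣⁅x⁆∣≡1 u₂))
                 (∣p∪q∣≤∣p∣+∣q∣ ⁅ u₁ ⁆ ⁅ u₂ ⁆)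

  ∣neighbours-leaf∣≤1 : x ∈ leaves → ∣ neighbours G x ∣ ≤ 1
  ∣neighbours-leaf∣≤1 =
    ∈leaves-elim (λ u → ∣ neighbours G u ∣ ≤ 1) (bound deg-u₁) (bound deg-u₂)
    where
    bound : ∀ {u} → degree G u ≡ 1 → ∣ neighbours G u ∣ ≤ 1
    bound {u} deg-u = ≤-reflexive (trans (sym (degree≡∣neighbours∣ G u)) deg-u)

  v∈neighbours-leaf : x ∈ leaves → v ∈ neighbours G x
  v∈neighbours-leaf = ∈leaves-elim (λ u → v ∈ neighbours G u)
    (neighbours-sym G (∈-neighbours⁺ G v~u₁)) (neighbours-sym G (∈-neighbours⁺ G v~u₂))

  neighbour-of-leaf≡v : x ∈ leaves → y ∈ neighbours G x → y ≡ v
  neighbour-of-leaf≡v x∈L y∈N =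
    x∈p∧y∈p∧∣p∣≤1⇒x≡y y∈N (v∈neighbours-leaf x∈L) (∣neighbours-leaf∣≤1 x∈L)

  v∉leaves : v ∉ leaves
  v∉leaves v∈L = x∉neighbours-x G (v∈neighbours-leaf v∈L)

  degreeOutside-leaf≤2 : ∀ S → x ∈ leaves → degreeOutside G S x ≤ 2
  degreeOutside-leaf≤2 {x = x} S x∈L =
    ≤-trans (degreeOutside≤∣q∣ G {S = S} {q = neighbours G x} (λ y∈N _ → y∈N))
            (≤-trans (∣neighbours-leaf∣≤1 x∈L) (s≤s z≤n))

  AvoidsLeaves : Subset n → Set
  AvoidsLeaves S = ∀ {u} → u ∈ leaves → u ∉ S

  swapLeavesForV : IsMinCPCP G S → Nonempty (S ∩ leaves) →
                   Σ[ T ∈ Subset n ] (IsMinCPCP G T × AvoidsLeaves T)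
  swapLeavesForV {S = S} S-min S∩leaves≢∅ =
    T , isMinCPCP-≤ G S-min T-cPCP ∣T∣≤∣S∣ , T-avoids
    where
    T : Subset n
    T = (S ─ leaves) ∪ ⁅ v ⁆

    ∈T : x ∈ S → x ∉ leaves → x ∈ T
    ∈T x∈S x∉L = x∈p∪q⁺ (inj₁ (x∈p∧x∉q⇒x∈p─q x∈S x∉L))

    v∈T : v ∈ T
    v∈T = x∈p∪q⁺ (inj₂ (x∈⁅x⁆ v))

    ∣T∣≤∣S∣ : ∣ T ∣ ≤ ∣ S ∣
    ∣T∣≤∣S∣ = ∣p∣<∣r∣∧∣q∣≤1⇒∣p∪q∣≤∣r∣ (S ─ leaves) ⁅ v ⁆ S
                (p∩q≢∅⇒∣p─q∣<∣p∣ S leaves S∩leaves≢∅) (≤-reflexive (∣⁅x⁆∣≡1 v))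

    T-avoids : AvoidsLeaves T
    T-avoids u∈L u∈T with x∈p∪q⁻ (S ─ leaves) ⁅ v ⁆ u∈T
    ... | inj₁ u∈S─L = x∈p─q⇒x∉q S leaves u∈S─L u∈L
    ... | inj₂ u∈⁅v⁆ = v∉leaves (subst (_∈ leaves) (x∈⁅y⁆⇒x≡y v u∈⁅v⁆) u∈L)

    T-cPCP : IsCPCP G T
    T-cPCP x x∉T with x ∈? leaves
    ... | yes x∈L = degreeOutside-leaf≤2 T x∈L
    ... | no  x∉L =
      ≤-trans (degreeOutside-mono G N∖T⊆∁S) (proj₁ S-min x λ x∈S → x∉T (∈T x∈S x∉L))
      where
      N∖T⊆∁S : ∀ {w} → w ∈ neighbours G x → w ∉ T → w ∉ S
      N∖T⊆∁S {w} w∈N w∉T w∈S with w ∈? leaves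
      ... | yes w∈L =
        x∉T (subst (_∈ T) (sym (neighbour-of-leaf≡v w∈L (neighbours-sym G w∈N))) v∈T)
      ... | no  w∉L = w∉T (∈T w∈S w∉L)

  swapVForOtherNeighbour : degree G v ≤ 3 → IsMinCPCP G S → AvoidsLeaves S → v ∈ S →
                           Σ[ T ∈ Subset n ] (IsMinCPCP G T × v ∉ T × AvoidsLeaves T)
  swapVForOtherNeighbour {S = S} deg-v≤3 S-min S-avoids v∈S =
    T , isMinCPCP-≤ G S-min T-cPCP ∣T∣≤∣S∣ , v∉T , T-avoids
    where
    -- {w} in the notation above, or ∅ when v has no third neighbour.
    otherNeighbours : Subset n
    otherNeighbours = neighbours G v ─ leaves

    ∣otherNeighbours∣≤1 : ∣ otherNeighbours ∣ ≤ 1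
    ∣otherNeighbours∣≤1 = s≤s⁻¹ (s≤s⁻¹ (begin
      2 + ∣ otherNeighbours ∣           ≡⟨ cong (λ r → 2 + ∣ r ∣)
                                             (p─q─r≡p─q∪r (neighbours G v) ⁅ u₁ ⁆ ⁅ u₂ ⁆) ⟨
      2 + ∣ neighbours G v - u₁ - u₂ ∣  ≤⟨ x∈p∧y∈p∧x≢y⇒2+∣p-x-y∣≤∣p∣ (∈-neighbours⁺ G v~u₁)
                                             (∈-neighbours⁺ G v~u₂) u₁≢u₂ ⟩
      ∣ neighbours G v ∣                ≡⟨ degree≡∣neighbours∣ G v ⟨
      degree G v                        ≤⟨ deg-v≤3 ⟩
      3                                 ∎))
      where open ≤-Reasoning

    T : Subset n
    T = (S - v) ∪ otherNeighbours

    ∈T : x ∈ S → x ≢ v → x ∈ T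
    ∈T x∈S x≢v = x∈p∪q⁺ (inj₁ (x∈p∧x≢y⇒x∈p-y x∈S x≢v))

    other∈T : x ∈ neighbours G v → x ∉ leaves → x ∈ T
    other∈T x∈N x∉L = x∈p∪q⁺ (inj₂ (x∈p∧x∉q⇒x∈p─q x∈N x∉L))

    ∣T∣≤∣S∣ : ∣ T ∣ ≤ ∣ S ∣
    ∣T∣≤∣S∣ = ∣p∣<∣r∣∧∣q∣≤1⇒∣p∪q∣≤∣r∣ (S - v) otherNeighbours S
                (x∈p⇒∣p-x∣<∣p∣ v∈S) ∣otherNeighbours∣≤1

    v∉T : v ∉ T
    v∉T v∈T with x∈p∪q⁻ (S - v) otherNeighbours v∈T
    ... | inj₁ v∈S-v = x∈p─q⇒x∉q S ⁅ v ⁆ v∈S-v (x∈⁅x⁆ v)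
    ... | inj₂ v∈other = x∉neighbours-x G (p─q⊆p (neighbours G v) leaves v∈other)

    T-avoids : AvoidsLeaves T
    T-avoids u∈L u∈T with x∈p∪q⁻ (S - v) otherNeighbours u∈T
    ... | inj₁ u∈S-v   = S-avoids u∈L (p─q⊆p S ⁅ v ⁆ u∈S-v)
    ... | inj₂ u∈other = x∈p─q⇒x∉q (neighbours G v) leaves u∈other u∈L

    T-cPCP : IsCPCP G T
    T-cPCP x x∉T with x ∈? leaves | x ≟ v
    ... | yes x∈L | _        = degreeOutside-leaf≤2 T x∈L
    ... | no  x∉L | yes refl = ≤-trans (degreeOutside≤∣q∣ G N∖T⊆leaves) ∣leaves∣≤2
      where
      N∖T⊆leaves : ∀ {w} → w ∈ neighbours G v → w ∉ T → w ∈ leaves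
      N∖T⊆leaves w∈N w∉T = decidable-stable (_ ∈? leaves) (w∉T ∘ other∈T w∈N)
    ... | no  x∉L | no  x≢v  =
      ≤-trans (degreeOutside-mono G N∖T⊆∁S) (proj₁ S-min x λ x∈S → x∉T (∈T x∈S x≢v))
      where
      N∖T⊆∁S : ∀ {w} → w ∈ neighbours G x → w ∉ T → w ∉ S
      N∖T⊆∁S {w} w∈N w∉T w∈S with w ≟ v
      ... | yes refl = x∉T (other∈T (neighbours-sym G w∈N) x∉L)
      ... | no  w≢v  = w∉T (∈T w∈S w≢v)

  minCPCP-avoiding-leaves : Σ[ S ∈ Subset n ] (IsMinCPCP G S × AvoidsLeaves S)
  minCPCP-avoiding-leaves with minCPCP-exists G
  ... | S , S-min with nonempty? (S ∩ leaves)
  ...   | yes S∩leaves≢∅ = swapLeavesForV S-min S∩leaves≢∅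
  ...   | no  S∩leaves≡∅ = S , S-min , λ u∈L u∈S → S∩leaves≡∅ (_ , x∈p∩q⁺ (u∈S , u∈L))

  minCPCP-avoiding-v-and-leaves : degree G v ≤ 3 →
                                  Σ[ S ∈ Subset n ] (IsMinCPCP G S × v ∉ S × AvoidsLeaves S)
  minCPCP-avoiding-v-and-leaves deg-v≤3 with minCPCP-avoiding-leaves
  ... | S , S-min , S-avoids with v ∈? S
  ...   | yes v∈S = swapVForOtherNeighbour deg-v≤3 S-min S-avoids v∈S
  ...   | no  v∉S = S , S-min , v∉S , S-avoids

lemma11 : ∀ {n} (G : Graph n) (v u₁ u₂ : Fin n) →
    ¬ (u₁ ≡ u₂) → Adj G v u₁ → Adj G v u₂ →
    degree G u₁ ≡ 1 → degree G u₂ ≡ 1 →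
    (Σ[ S ∈ Subset n ] (IsMinCPCP G S × u₁ ∉ S × u₂ ∉ S))
    × (degree G v ≤ 3 →
        Σ[ S ∈ Subset n ] (IsMinCPCP G S × v ∉ S × u₁ ∉ S × u₂ ∉ S))
lemma11 {n} G v u₁ u₂ u₁≢u₂ v~u₁ v~u₂ deg-u₁ deg-u₂ =
  avoiding-u₁-u₂ minCPCP-avoiding-leaves ,
  avoiding-v-u₁-u₂ ∘ minCPCP-avoiding-v-and-leaves
  where
  open TwoLeaves G u₁≢u₂ v~u₁ v~u₂ deg-u₁ deg-u₂

  avoiding-u₁-u₂ : Σ[ S ∈ Subset n ] (IsMinCPCP G S × AvoidsLeaves S) →
                   Σ[ S ∈ Subset n ] (IsMinCPCP G S × u₁ ∉ S × u₂ ∉ S)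
  avoiding-u₁-u₂ (S , S-min , S-avoids) = S , S-min , S-avoids u₁∈leaves , S-avoids u₂∈leaves

  avoiding-v-u₁-u₂ : Σ[ S ∈ Subset n ] (IsMinCPCP G S × v ∉ S × AvoidsLeaves S) →
                     Σ[ S ∈ Subset n ] (IsMinCPCP G S × v ∉ S × u₁ ∉ S × u₂ ∉ S)
  avoiding-v-u₁-u₂ (S , S-min , v∉S , S-avoids) =
    S , S-min , v∉S , S-avoids u₁∈leaves , S-avoids u₂∈leaves
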